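{- Let $u,v,w$ be factors of the Zimin word $Z$ with $k(u)<k(v)<k(w)$. Then (1) if $uv$ and $vw$ are factors of $Z$, then $uvw$ is a factor of $Z$; (2) if $uw$ and $vw$ are factors of $Z$, then $u$ is a suffix of $v$.
   Context: Alphabet $\{x_1,x_2,\ldots\}$; $Z_1=x_1$, $Z_{m+1}=Z_mx_{m+1}Z_m$, and the Zimin word is $Z=\lim Z_m=x_1x_2x_1x_3x_1x_2x_1x_4\ldots$. A factor is a nonempty finite word occurring in $Z$. For a factor $u$, $k(u)=\max\{k: x_k\text{ occurs in }u\}$. -}

module Defs where

open import Data.Nat using (ℕ; zero; suc; _⊔_)
open import Data.List using (List; []; _∷_; _++_; foldr)
open import Data.Product using (Σ; ∃; _×_; _,_)
open import Relation.Binary.PropositionalEquality using (_≡_; _≢_)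

-- Letters: the letter x_n is represented by the natural number n (n ≥ 1).
Word : Set
Word = List ℕ

-- Zimin words: zimin m = Z_{m+1};  Z_1 = x_1,  Z_{m+1} = Z_m x_{m+1} Z_m.
zimin : ℕ → Word
zimin zero    = 1 ∷ []
zimin (suc m) = zimin m ++ (suc (suc m) ∷ zimin m)

_InfixOf_ : Word → Word → Set
u InfixOf w = ∃ λ p → ∃ λ s → p ++ u ++ s ≡ w

_SuffixOf_ : Word → Word → Set
u SuffixOf v = ∃ λ p → p ++ u ≡ v

-- A factor of the infinite Zimin word Z = lim Z_m: a nonempty finite word
-- occurring in Z, i.e. occurring in some Z_m (each Z_m is a prefix of Z).
Factor : Word → Set
Factor u = (u ≢ []) × (∃ λ m → u InfixOf zimin m)

k : Word → ℕ
k = foldr _⊔_ 0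

-- Write y = a x_J b with J = k(y) ≥ 2 and x_J the first occurrence of the maximal letter.
-- In Z every x_J is preceded by a copy of Z_{J-1}, and a block of letters below x_J that
-- ends just before it lies inside this copy (induction along Z_{m+1} = Z_m x_{m+1} Z_m).
-- Hence if x y is a factor with k(x) < J, then x a is a suffix of Z_{J-1}, and every
-- occurrence of y extends to the left to an occurrence of Z_{J-1} x_J b.  For (1) take
-- y = v: the extension of an occurrence of v w already contains u in front.  For (2) take
-- y = w: u a and v a are both suffixes of Z_{J-1}, so one of u, v is a suffix of the other,
-- and v being a suffix of u would give k(v) ≤ k(u).
module Submission where

open import Defs
open import Data.Nat using (ℕ; zero; suc; _<_; _≤_; s≤s; z≤n; _≟_)
open import Data.Nat.Properties
  using (≤-refl; ≤-trans; <-trans; ≤-<-trans; <⇒≱; ≤∧≢⇒<; m≤m⊔n; m≤n⊔m; ⊔-sel; m≤n⇒m≤1+n; n≤1+n)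
open import Data.List using ([]; _∷_; _++_)
open import Data.List.Properties using (∷-injective; ++-assoc; ++-cancelʳ; ++-conicalˡ)
open import Data.List.Membership.Propositional using (_∈_)
open import Data.List.Membership.Propositional.Properties using (∈-insert)
open import Data.List.Relation.Unary.All as All using (All; []; _∷_)
open import Data.List.Relation.Unary.All.Properties using (++⁺; ++⁻ˡ; ++⁻ʳ)
open import Data.List.Relation.Unary.Any using (here)
open import Data.Product using (_×_; _,_; proj₁; ∃; ∃₂)
open import Data.Sum using (_⊎_; inj₁; inj₂)
open import Data.Empty using (⊥-elim)
open import Relation.Nullary using (yes; no)
open import Relation.Binary.PropositionalEquality
  using (_≡_; refl; sym; trans; cong; subst; module ≡-Reasoning)
open ≡-Reasoning

private
  variable
    x y : ℕ
    xs ys vs c : Word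

++-≡-++ : ∀ (p : Word) {x} q {y} → p ++ x ≡ q ++ y →
  (∃ λ c → q ≡ p ++ c × x ≡ c ++ y) ⊎ (∃ λ c → p ≡ q ++ c × y ≡ c ++ x)
++-≡-++ []      q       e = inj₁ (q , refl , e)
++-≡-++ (a ∷ p) []      e = inj₂ (a ∷ p , refl , sym e)
++-≡-++ (a ∷ p) (b ∷ q) e with refl , e′ ← ∷-injective e with ++-≡-++ p q e′
... | inj₁ (c , q≡ , x≡) = inj₁ (c , cong (a ∷_) q≡ , x≡)
... | inj₂ (c , p≡ , y≡) = inj₂ (c , cong (a ∷_) p≡ , y≡)

∷-positions : ∀ (xs us : Word) → xs ++ x ∷ ys ≡ us ++ y ∷ vs →
  (xs ≡ us × x ≡ y × ys ≡ vs)
  ⊎ (∃ λ t → us ≡ xs ++ x ∷ t × ys ≡ t ++ y ∷ vs)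
  ⊎ (∃ λ t → xs ≡ us ++ y ∷ t × vs ≡ t ++ x ∷ ys)
∷-positions []       []       e with refl , ys≡vs ← ∷-injective e = inj₁ (refl , refl , ys≡vs)
∷-positions []       (u ∷ us) e with refl , ys≡ ← ∷-injective e = inj₂ (inj₁ (us , refl , ys≡))
∷-positions (z ∷ xs) []       e with refl , vs≡ ← ∷-injective e = inj₂ (inj₂ (xs , refl , sym vs≡))
∷-positions (z ∷ xs) (u ∷ us) e with refl , e′ ← ∷-injective e with ∷-positions xs us e′
... | inj₁ (refl , x≡y , ys≡vs)    = inj₁ (refl , x≡y , ys≡vs)
... | inj₂ (inj₁ (t , us≡ , ys≡)) = inj₂ (inj₁ (t , cong (z ∷_) us≡ , ys≡))
... | inj₂ (inj₂ (t , xs≡ , vs≡)) = inj₂ (inj₂ (t , cong (z ∷_) xs≡ , vs≡))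

∈-or-∷-before : ∀ (p a q : Word) {x s} → p ++ a ≡ q ++ x ∷ s →
  x ∈ a ⊎ ∃ λ p′ → p ≡ q ++ x ∷ p′ × s ≡ p′ ++ a
∈-or-∷-before p a q e with ++-≡-++ p q e
... | inj₁ (c , _ , refl)        = inj₁ (∈-insert c)
... | inj₂ ([] , _ , refl)       = inj₁ (here refl)
... | inj₂ (z ∷ c , p≡ , x∷s≡) with refl , s≡ ← ∷-injective x∷s≡ = inj₂ (c , p≡ , s≡)

SuffixOf-total : xs SuffixOf c → ys SuffixOf c → xs SuffixOf ys ⊎ ys SuffixOf xs
SuffixOf-total (p , e) (q , e′) with ++-≡-++ p q (trans e (sym e′))
... | inj₁ (d , _ , xs≡) = inj₂ (d , sym xs≡)
... | inj₂ (d , _ , ys≡) = inj₁ (d , sym ys≡)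

SuffixOf-cancelʳ : ∀ a → (xs ++ a) SuffixOf (ys ++ a) → xs SuffixOf ys
SuffixOf-cancelʳ {xs} {ys} a (p , e) = p , ++-cancelʳ a (p ++ xs) ys (trans (++-assoc p xs a) e)

InfixOf-++⁻ʳ : ∀ p → (p ++ xs) InfixOf ys → xs InfixOf ys
InfixOf-++⁻ʳ {xs} p (q , s , e) = q ++ p , s , (begin
  (q ++ p) ++ xs ++ s ≡⟨ ++-assoc q p (xs ++ s) ⟩
  q ++ p ++ xs ++ s   ≡⟨ cong (q ++_) (sym (++-assoc p xs s)) ⟩
  q ++ (p ++ xs) ++ s ≡⟨ e ⟩
  _                   ∎)

All-InfixOf : ∀ {P : ℕ → Set} → All P ys → xs InfixOf ys → All P xs
All-InfixOf {xs = xs} all (p , s , refl) = ++⁻ˡ xs (++⁻ʳ p all)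

All-≤-k : ∀ xs → All (_≤ k xs) xs
All-≤-k []       = []
All-≤-k (x ∷ xs) = m≤m⊔n x (k xs) ∷ All.map (λ y≤ → ≤-trans y≤ (m≤n⊔m x (k xs))) (All-≤-k xs)

k<⇒All< : ∀ {n} xs → k xs < n → All (_< n) xs
k<⇒All< xs k<n = All.map (λ y≤ → ≤-<-trans y≤ k<n) (All-≤-k xs)

k-SuffixOf : xs SuffixOf ys → k xs ≤ k ys
k-SuffixOf ([]    , refl) = ≤-refl
k-SuffixOf (z ∷ p , refl) = ≤-trans (k-SuffixOf (p , refl)) (m≤n⊔m z _)

max-letter-split : ∀ {n} ys → k ys ≡ suc n →
  ∃₂ λ a b → ys ≡ a ++ suc n ∷ b × All (_< suc n) a
max-letter-split {n} (y ∷ ys) kys≡ with y ≟ suc n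
... | yes refl = [] , ys , refl , []
... | no y≢ with ⊔-sel y (k ys)
...   | inj₁ y⊔≡y = ⊥-elim (y≢ (trans (sym y⊔≡y) kys≡))
...   | inj₂ y⊔≡k with a , b , refl , a< ← max-letter-split ys (trans (sym y⊔≡k) kys≡) =
  y ∷ a , b , refl , ≤∧≢⇒< (subst (y ≤_) kys≡ (m≤m⊔n y (k ys))) y≢ ∷ a<

zimin-letters-positive : ∀ m → All (1 ≤_) (zimin m)
zimin-letters-positive zero    = s≤s z≤n ∷ []
zimin-letters-positive (suc m) = ++⁺ ih (s≤s z≤n ∷ ih)
  where ih = zimin-letters-positive m

zimin-letters-≤ : ∀ m → All (_≤ suc m) (zimin m)
zimin-letters-≤ zero    = ≤-refl ∷ []
zimin-letters-≤ (suc m) = ++⁺ ih (≤-refl ∷ ih)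
  where ih = All.map m≤n⇒m≤1+n (zimin-letters-≤ m)

occurs-in-zimin-≤ : ∀ m p {r} → p ++ x ∷ r ≡ zimin m → x ≤ suc m
occurs-in-zimin-≤ m p e = All.lookup (zimin-letters-≤ m) (subst (_ ∈_) e (∈-insert p))

Factor⇒1≤k : Factor xs → 1 ≤ k xs
Factor⇒1≤k {[]}     (xs≢[] , _) = ⊥-elim (xs≢[] refl)
Factor⇒1≤k {x ∷ xs} (_ , m , occ) with 1≤x ∷ _ ← All-InfixOf (zimin-letters-positive m) occ =
  ≤-trans 1≤x (m≤m⊔n x (k xs))

k-above-factor-≡2+ : ∀ xs ys → Factor xs → k xs < k ys → ∃ λ j → k ys ≡ suc (suc j)
k-above-factor-≡2+ xs ys fxs kxs<kys with k ys | ≤-<-trans (Factor⇒1≤k fxs) kxs<kys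
... | suc (suc j) | _       = j , refl
... | suc zero    | s≤s ()

-- zimin (1 + m) = zimin m ++ 2 + m ∷ zimin m: the occurrence of 2 + j is the middle letter
-- (then j = m) or lies in one copy of zimin m; the block a cannot reach back over the
-- middle letter, which exceeds every letter of zimin m and hence 2 + j.
preceded-by-zimin : ∀ j m p a {r} → All (_< suc (suc j)) a →
  p ++ a ++ suc (suc j) ∷ r ≡ zimin m →
  ∃ λ c → c ++ a ≡ zimin j × c SuffixOf p
preceded-by-zimin j zero p a _ e
  with s≤s () ← occurs-in-zimin-≤ 0 (p ++ a) (trans (++-assoc p a _) e)
preceded-by-zimin j (suc m) p a {r} a< e
  with ∷-positions (p ++ a) (zimin m) (trans (++-assoc p a _) e)
... | inj₁ (pa≡ , refl , _)       = p , pa≡ , [] , refl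
... | inj₂ (inj₁ (t , zm≡ , _))  =
  preceded-by-zimin j m p a a< (trans (sym (++-assoc p a _)) (sym zm≡))
... | inj₂ (inj₂ (t , pa≡ , zm≡))
  with ∈-or-∷-before p a (zimin m) pa≡
...   | inj₁ M∈a = ⊥-elim (<⇒≱ (All.lookup a< M∈a) (≤-trans J≤ (n≤1+n _)))
  where J≤ = occurs-in-zimin-≤ m t (sym zm≡)
...   | inj₂ (p′ , refl , refl)
  with c , ca≡ , q , refl ← preceded-by-zimin j m p′ a a<
                               (trans (sym (++-assoc p′ a _)) (sym zm≡)) =
  c , ca≡ , zimin m ++ _ ∷ q , ++-assoc (zimin m) (_ ∷ q) c

occurrence-extends-to-zimin : ∀ j m a {r} → All (_< suc (suc j)) a →
  (a ++ suc (suc j) ∷ r) InfixOf zimin m →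
  ∃ λ c → c ++ a ≡ zimin j × (c ++ a ++ suc (suc j) ∷ r) InfixOf zimin m
occurrence-extends-to-zimin j m a {r} a< (p , s , e)
  with c , ca≡ , q , refl ← preceded-by-zimin j m p a a<
                               (trans (cong (p ++_) (sym (++-assoc a _ s))) e) =
  c , ca≡ , q , s , (begin
    q ++ (c ++ w) ++ s ≡⟨ cong (q ++_) (++-assoc c w s) ⟩
    q ++ c ++ w ++ s   ≡⟨ sym (++-assoc q c (w ++ s)) ⟩
    (q ++ c) ++ w ++ s ≡⟨ e ⟩
    zimin m            ∎)
  where w = a ++ suc (suc j) ∷ r

before-letter-SuffixOf-zimin : ∀ j xs a {b} → k xs < suc (suc j) → All (_< suc (suc j)) a →
  Factor (xs ++ a ++ suc (suc j) ∷ b) → (xs ++ a) SuffixOf zimin j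
before-letter-SuffixOf-zimin j xs a kxs< a< (_ , m , occ)
  with c , cxsa≡ , _ ← occurrence-extends-to-zimin j m (xs ++ a) (++⁺ (k<⇒All< xs kxs<) a<)
                         (subst (_InfixOf zimin m) (sym (++-assoc xs a _)) occ) =
  c , cxsa≡

glue-at-letter : ∀ j xs a {b ys} → k xs < suc (suc j) → All (_< suc (suc j)) a →
  Factor (xs ++ a ++ suc (suc j) ∷ b) → Factor (a ++ suc (suc j) ∷ ys) →
  ∃ λ m → (xs ++ a ++ suc (suc j) ∷ ys) InfixOf zimin m
glue-at-letter j xs a kxs< a< fxsa (_ , m , occ)
  with d , dxsa≡ ← before-letter-SuffixOf-zimin j xs a kxs< a< fxsa
  with c , ca≡ , occ′ ← occurrence-extends-to-zimin j m a a< occ =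
  m , InfixOf-++⁻ʳ d (subst (_InfixOf zimin m) (trans (cong (_++ _) c≡dxs) (++-assoc d xs _)) occ′)
  where
  c≡dxs : c ≡ d ++ xs
  c≡dxs = ++-cancelʳ a c (d ++ xs) (begin
    c ++ a         ≡⟨ trans ca≡ (sym dxsa≡) ⟩
    d ++ xs ++ a   ≡⟨ sym (++-assoc d xs a) ⟩
    (d ++ xs) ++ a ∎)

factor-glue : ∀ u v w → Factor u → k u < k v →
  Factor (u ++ v) → Factor (v ++ w) → Factor (u ++ v ++ w)
factor-glue u v w fu ku<kv fuv fvw
  with j , kv≡ ← k-above-factor-≡2+ u v fu ku<kv
  with a , b , refl , a< ← max-letter-split v kv≡
  with m , occ ← glue-at-letter j u a (subst (k u <_) kv≡ ku<kv) a< fuv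
                   (subst Factor (++-assoc a _ w) fvw) =
  (λ uvw≡[] → proj₁ fu (++-conicalˡ u _ uvw≡[])) , m ,
  subst (λ t → (u ++ t) InfixOf zimin m) (sym (++-assoc a _ w)) occ

common-right-factor⇒SuffixOf : ∀ u v w → Factor u → k u < k v → k v < k w →
  Factor (u ++ w) → Factor (v ++ w) → u SuffixOf v
common-right-factor⇒SuffixOf u v w fu ku<kv kv<kw fuw fvw
  with j , kw≡ ← k-above-factor-≡2+ u w fu (<-trans ku<kv kv<kw)
  with a , b , refl , a< ← max-letter-split w kw≡
  with SuffixOf-total
         (before-letter-SuffixOf-zimin j u a (subst (k u <_) kw≡ (<-trans ku<kv kv<kw)) a< fuw)
         (before-letter-SuffixOf-zimin j v a (subst (k v <_) kw≡ kv<kw) a< fvw)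
... | inj₁ ua⊑va = SuffixOf-cancelʳ a ua⊑va
... | inj₂ va⊑ua = ⊥-elim (<⇒≱ ku<kv (k-SuffixOf (SuffixOf-cancelʳ a va⊑ua)))

corollary1 : ∀ u v w → Factor u → Factor v → Factor w → k u < k v → k v < k w →
    ((Factor (u ++ v) → Factor (v ++ w) → Factor (u ++ v ++ w))
    × (Factor (u ++ w) → Factor (v ++ w) → u SuffixOf v))
corollary1 u v w fu _ _ ku<kv kv<kw =
  factor-glue u v w fu ku<kv , common-right-factor⇒SuffixOf u v w fu ku<kv kv<kw
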